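{- Let $(a_n)_{n\ge1}$ be defined by $a_1=1$ and $a_n=a_{n-1}+\operatorname{lcm}(n,a_{n-1})$ for $n\ge2$. For $m\ge 1$ let $C_m=\prod_{q\le m,\ q\in\mathbb{P},\ q\ne 3}(q+1)$ (an empty product being $1$, so $C_1=1$). Then for every $n\ge2$, $C_{n-1}\mid a_{n-1}$.
   Context: $\mathbb{P}$ denotes the set of prime numbers. -}

module Defs where

open import Data.Nat using (ℕ; zero; suc; _+_; _*_; _∸_)
open import Data.Nat.LCM using (lcm)
open import Data.Nat.Primality using (prime?)
open import Data.Nat.Properties using (_≟_)
open import Relation.Nullary using (yes; no)

-- b k = a_{k+1}:  a_1 = 1,  a_{k+2} = a_{k+1} + lcm (k+2) a_{k+1}
b : ℕ → ℕ
b zero = 1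
b (suc k) = b k + lcm (suc (suc k)) (b k)

-- a n for n ≥ 1 (a 0 is a junk value = a 1; never used)
a : ℕ → ℕ
a n = b (n ∸ 1)

factor : ℕ → ℕ
factor q with prime? q | q ≟ 3
... | yes _ | no _ = suc q
... | _     | _    = 1

C : ℕ → ℕ
C zero = 1
C (suc m) = C m * factor (suc m)

-- Writing g = gcd(n, a_{n-1}), the recurrence reads a_n = (1 + n/g) a_{n-1}, so each a_{n-1}
-- divides a_n.  A prime p ≠ 3 never divides a_m for m < p: a prime that first appears in a_{m+1}
-- divides 1 + (m+1)/g ≤ m + 2, and p = m + 2 would force g = 1, whereas for p ≥ 5 both m + 1
-- and a_m are even.  Hence at the prime index p ≠ 3 we have g = 1 and a_p = (p + 1) a_{p-1},
-- which supplies the factor p + 1 of C_p.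
module Submission where

open import Defs
open import Data.Nat using (ℕ; zero; suc; _+_; _*_; _∸_; _≥_; _≤_; s≤s; NonZero; ≢-nonZero; ≢-nonZero⁻¹)
open import Data.Nat.Properties using (_≟_; *-comm; *-assoc; *-identityʳ; *-cancelˡ-≡; ≤-refl; ≤-trans; ≤-antisym; suc-injective; n≤1+n)
open import Data.Nat.Divisibility using (_∣_; _∤_; divides; ∣⇒≤; ∣-trans; ∣1⇒≡1; *-pres-∣; ∣-refl; module ∣-Reasoning)
open import Data.Nat.GCD using (gcd; gcd[m,n]∣m; gcd[m,n]≢0)
open import Data.Nat.LCM using (lcm; gcd*lcm)
open import Data.Nat.Coprimality using (Coprime; gcd≡1⇒coprime; coprime⇒gcd≡1)
open import Data.Nat.Primality using (Prime; prime?; prime⇒irreducible; euclidsLemma; composite⇒¬prime; composite[4])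
open import Data.Product using (_×_; _,_)
open import Data.Sum using (_⊎_; inj₁; inj₂)
open import Relation.Nullary using (¬_; yes; no; contradiction)
open import Relation.Binary.PropositionalEquality using (_≡_; _≢_; refl; sym; trans; cong; subst; module ≡-Reasoning)

-- n / gcd n m, taken as the quotient of gcd n m ∣ n so that no NonZero instance is needed.
cofactor : ℕ → ℕ → ℕ
cofactor n m = _∣_.quotient (gcd[m,n]∣m n m)

n≡cofactor*gcd : ∀ n m → n ≡ cofactor n m * gcd n m
n≡cofactor*gcd n m = _∣_.equality (gcd[m,n]∣m n m)

cofactor∣n : ∀ n m → cofactor n m ∣ n
cofactor∣n n m = divides (gcd n m) (trans (n≡cofactor*gcd n m) (*-comm (cofactor n m) (gcd n m)))

lcm≡cofactor* : ∀ n m .{{_ : NonZero n}} → lcm n m ≡ cofactor n m * m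
lcm≡cofactor* n m = *-cancelˡ-≡ (lcm n m) (t * m) g {{gcd≢0}} (begin
  g * lcm n m ≡⟨ gcd*lcm n m ⟩
  n * m       ≡⟨ cong (_* m) (n≡cofactor*gcd n m) ⟩
  t * g * m   ≡⟨ cong (_* m) (*-comm t g) ⟩
  g * t * m   ≡⟨ *-assoc g t m ⟩
  g * (t * m) ∎)
  where
  open ≡-Reasoning
  g = gcd n m
  t = cofactor n m
  gcd≢0 : NonZero g
  gcd≢0 = ≢-nonZero (gcd[m,n]≢0 n m (inj₁ (≢-nonZero⁻¹ n)))

cofactor≡⇒coprime : ∀ n m .{{_ : NonZero n}} → cofactor n m ≡ n → Coprime n m
cofactor≡⇒coprime n m t≡n = gcd≡1⇒coprime (sym (*-cancelˡ-≡ 1 (gcd n m) n (begin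
  n * 1                  ≡⟨ *-identityʳ n ⟩
  n                      ≡⟨ n≡cofactor*gcd n m ⟩
  cofactor n m * gcd n m ≡⟨ cong (_* gcd n m) t≡n ⟩
  n * gcd n m            ∎)))
  where open ≡-Reasoning

coprime⇒cofactor≡ : ∀ {n m} → Coprime n m → cofactor n m ≡ n
coprime⇒cofactor≡ {n} {m} coprime = sym (begin
  n                      ≡⟨ n≡cofactor*gcd n m ⟩
  cofactor n m * gcd n m ≡⟨ cong (cofactor n m *_) (coprime⇒gcd≡1 coprime) ⟩
  cofactor n m * 1       ≡⟨ *-identityʳ (cofactor n m) ⟩
  cofactor n m           ∎)
  where open ≡-Reasoning

prime∤⇒coprime : ∀ {p m} → Prime p → p ∤ m → Coprime p m
prime∤⇒coprime pp p∤m (i∣p , i∣m) with prime⇒irreducible pp i∣p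
... | inj₁ i≡1 = i≡1
... | inj₂ refl = contradiction i∣m p∤m

-- A prime entering m + lcm n m = (1 + n / gcd n m) * m is at most n + 1; at n + 1 the cofactor is all of n.
prime∣+lcm⇒coprime : ∀ {p n m} .{{_ : NonZero n}} → Prime p → p ∤ m → p ∣ m + lcm n m →
                     suc n ≤ p → p ≡ suc n × Coprime n m
prime∣+lcm⇒coprime {p} {n} {m} pp p∤m p∣sum n<p
  with euclidsLemma (suc (cofactor n m)) m pp (subst (p ∣_) (cong (m +_) (lcm≡cofactor* n m)) p∣sum)
... | inj₂ p∣m = contradiction p∣m p∤m
... | inj₁ p∣1+t = p≡1+n , cofactor≡⇒coprime n m (suc-injective (≤-antisym 1+t≤1+n (subst (_≤ _) p≡1+n p≤1+t)))
  where
  p≤1+t : p ≤ suc (cofactor n m)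
  p≤1+t = ∣⇒≤ p∣1+t
  1+t≤1+n : suc (cofactor n m) ≤ suc n
  1+t≤1+n = s≤s (∣⇒≤ (cofactor∣n n m))
  p≡1+n : p ≡ suc n
  p≡1+n = ≤-antisym (≤-trans p≤1+t 1+t≤1+n) n<p

parity : ∀ n → 2 ∣ n ⊎ 2 ∣ suc n
parity zero = inj₁ (divides 0 refl)
parity (suc n) with parity n
... | inj₁ 2∣n = inj₂ (divides (suc (_∣_.quotient 2∣n)) (cong (λ k → suc (suc k)) (_∣_.equality 2∣n)))
... | inj₂ 2∣1+n = inj₁ 2∣1+n

2∣pred-odd-prime : ∀ {n} → Prime (suc n) → suc n ≢ 2 → 2 ∣ n
2∣pred-odd-prime {n} pp 1+n≢2 with parity n
... | inj₁ 2∣n = 2∣n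
... | inj₂ 2∣1+n with prime⇒irreducible pp 2∣1+n
...   | inj₁ ()
...   | inj₂ 2≡1+n = contradiction (sym 2≡1+n) 1+n≢2

b-suc : ∀ k → b (suc k) ≡ suc (cofactor (2 + k) (b k)) * b k
b-suc k = cong (b k +_) (lcm≡cofactor* (2 + k) (b k))

b∣b-suc : ∀ k → b k ∣ b (suc k)
b∣b-suc k = divides (suc (cofactor (2 + k) (b k))) (b-suc k)

2∣b : ∀ k → 2 ∣ b (2 + k)
2∣b zero = divides 3 refl
2∣b (suc k) = ∣-trans (2∣b k) (b∣b-suc (2 + k))

¬coprime-b : ∀ j → Prime (3 + j) → 3 + j ≢ 3 → ¬ Coprime (2 + j) (b j)
¬coprime-b zero _ ≢3 _ = ≢3 refl
¬coprime-b (suc zero) pp _ _ = composite⇒¬prime composite[4] pp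
¬coprime-b (suc (suc i)) pp _ coprime with coprime (2∣pred-odd-prime pp (λ ()) , 2∣b i)
... | ()

prime∤b : ∀ {p} → Prime p → p ≢ 3 → ∀ k → 2 + k ≤ p → p ∤ b k
prime∤b pp ≢3 zero (s≤s (s≤s _)) p∣1 with ∣1⇒≡1 p∣1
... | ()
prime∤b pp ≢3 (suc j) 3+j≤p p∣b
  with prime∣+lcm⇒coprime pp (prime∤b pp ≢3 j (≤-trans (n≤1+n _) 3+j≤p)) p∣b 3+j≤p
... | refl , coprime = ¬coprime-b j pp ≢3 coprime

factor-cases : ∀ q → factor q ≡ 1 ⊎ (Prime q × q ≢ 3 × factor q ≡ suc q)
factor-cases q with prime? q | q ≟ 3
... | yes pq | no ≢3 = inj₂ (pq , ≢3 , refl)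
... | yes _  | yes _ = inj₁ refl
... | no _   | _     = inj₁ refl

C∣b : ∀ k → C (suc k) ∣ b k
C∣b zero = divides 1 refl
C∣b (suc k) with factor-cases (2 + k)
... | inj₁ factor≡1 = begin
  C (1 + k) * factor (2 + k) ≡⟨ cong (C (1 + k) *_) factor≡1 ⟩
  C (1 + k) * 1              ≡⟨ *-identityʳ (C (1 + k)) ⟩
  C (1 + k)                  ∣⟨ C∣b k ⟩
  b k                        ∣⟨ b∣b-suc k ⟩
  b (1 + k)                  ∎
  where open ∣-Reasoning
... | inj₂ (pp , ≢3 , factor≡3+k) = begin
  C (1 + k) * factor (2 + k)           ≡⟨ cong (C (1 + k) *_) factor≡3+k ⟩
  C (1 + k) * (3 + k)                  ∣⟨ *-pres-∣ (C∣b k) (∣-refl {3 + k}) ⟩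
  b k * (3 + k)                        ≡⟨ *-comm (b k) (3 + k) ⟩
  (3 + k) * b k                        ≡⟨ cong (λ t → suc t * b k) cofactor≡2+k ⟨
  suc (cofactor (2 + k) (b k)) * b k   ≡⟨ b-suc k ⟨
  b (1 + k)                            ∎
  where
  open ∣-Reasoning
  cofactor≡2+k : cofactor (2 + k) (b k) ≡ 2 + k
  cofactor≡2+k = coprime⇒cofactor≡ (prime∤⇒coprime pp (prime∤b pp ≢3 k ≤-refl))

proposition4p4 : ∀ (n : ℕ) → n ≥ 2 → C (n ∸ 1) ∣ a (n ∸ 1)
proposition4p4 (suc zero) (s≤s ())
proposition4p4 (suc (suc m)) _ = C∣b m
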